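{- Let $n>1$ be odd and $m\ge 3$. Then $\chi_{ld}(P_m[\overline{K_n}])\le 4$ if $m\equiv 1 \pmod 4$, $\chi_{ld}(P_m[\overline{K_n}])\le 3$ if $m\equiv 3\pmod 4$, and $\chi_{ld}(P_m[\overline{K_n}])\le 4$ if $m$ is even.
   Context: For a graph $G=(V,E)$ of order $N$ and a bijection $f\colon V\to\{1,\dots,N\}$, the weight of a vertex $u$ is $w(u)=\sum_{x\in N(u)}f(x)$, where $N(u)$ is the open neighborhood of $u$. The bijection $f$ is a local distance antimagic labeling if $w(u)\neq w(v)$ for every edge $uv$. $\chi_{ld}(G)$ is the minimum number of distinct weights over all local distance antimagic labelings of $G$. $P_m$ is the path on $m$ vertices; $\overline{K_n}$ is the edgeless graph on $n$ vertices. The lexicographic product $G[H]$ has vertex set $V(G)\times V(H)$, with $(g,h)$ adjacent to $(g',h')$ iff $gg'\in E(G)$, or $g=g'$ and $hh'\in E(H)$. -}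

module Defs where

open import Data.Nat using (ℕ; zero; suc; _+_; _*_; _≟_; _≤_)
open import Data.Fin using (Fin; toℕ)
open import Data.Fin.Properties as FinP using ()
open import Data.Product using (Σ; _×_; _,_; proj₁; proj₂)
open import Data.Sum using (_⊎_; inj₁; inj₂)
open import Data.Empty using (⊥)
open import Data.Nat.ListAction using (sum)
open import Data.List using (List; map; filter; allFin; cartesianProduct; length; deduplicate)
open import Function.Bundles using (_⤖_; Bijection)
open import Relation.Binary.PropositionalEquality using (_≡_)
open import Relation.Nullary using (Dec; yes; no; ¬_)
open import Relation.Nullary.Decidable using (_⊎-dec_; _×-dec_)

PathAdj : (m : ℕ) → Fin m → Fin m → Set
PathAdj m i j = (suc (toℕ i) ≡ toℕ j) ⊎ (suc (toℕ j) ≡ toℕ i)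

pathAdj? : (m : ℕ) → (i j : Fin m) → Dec (PathAdj m i j)
pathAdj? m i j = (suc (toℕ i) ≟ toℕ j) ⊎-dec (suc (toℕ j) ≟ toℕ i)

EmptyAdj : (n : ℕ) → Fin n → Fin n → Set
EmptyAdj n a b = ⊥

emptyAdj? : (n : ℕ) → (a b : Fin n) → Dec (EmptyAdj n a b)
emptyAdj? n a b = no (λ ())

V : ℕ → ℕ → Set
V m n = Fin m × Fin n

LexAdj : (m n : ℕ) → V m n → V m n → Set
LexAdj m n (g , h) (g' , h') = PathAdj m g g' ⊎ ((g ≡ g') × EmptyAdj n h h')

lexAdj? : (m n : ℕ) → (u v : V m n) → Dec (LexAdj m n u v)
lexAdj? m n (g , h) (g' , h') =
  pathAdj? m g g' ⊎-dec ((g FinP.≟ g') ×-dec emptyAdj? n h h')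

vertices : (m n : ℕ) → List (V m n)
vertices m n = cartesianProduct (allFin m) (allFin n)

-- A labeling: bijection V → {1,…,N}, N = m n, encoded via Fin (m * n)
-- with label value toℕ (f v) + 1.
Labeling : (m n : ℕ) → Set
Labeling m n = V m n ⤖ Fin (m * n)

label : {m n : ℕ} → Labeling m n → V m n → ℕ
label f v = suc (toℕ (Bijection.to f v))

nbhd : (m n : ℕ) → V m n → List (V m n)
nbhd m n u = filter (lexAdj? m n u) (vertices m n)

weight : {m n : ℕ} → Labeling m n → V m n → ℕ
weight {m} {n} f u = sum (map (label f) (nbhd m n u))

IsLDA : {m n : ℕ} → Labeling m n → Set
IsLDA {m} {n} f = (u v : V m n) → LexAdj m n u v → ¬ (weight f u ≡ weight f v)

numWeights : {m n : ℕ} → Labeling m n → ℕ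
numWeights {m} {n} f = length (deduplicate _≟_ (map (weight f) (vertices m n)))

-- χ_ld(P_m[\overline{K_n}]) ≤ k  (χ_ld is a minimum over a finite set, so
-- this holds iff some local distance antimagic labeling uses ≤ k weights).
χld≤ : (m n k : ℕ) → Set
χld≤ m n k = Σ (Labeling m n) (λ f → IsLDA f × (numWeights f ≤ k))

-- Label (g , h) by m·h + σ_h(g) + 1 for permutations σ_h of the path positions. As (g , h) is
-- adjacent to exactly the vertices of the neighbouring rows, w(g , h) is the sum of the row sums R
-- over the path neighbours of g. Taking σ_0 = reverse, σ_1 = σ_2 = unshuffle (even positions to
-- the front half, odd ones to the back half) and the other n − 3 columns in identity/reverse
-- pairs makes R(g) = base + (g mod 2)·δ with 0 < δ < base. All path neighbours of g have the
-- parity of g + 1, so w(g , h) = deg(g)·R(g + 1) ∈ {R₀, R₁, 2R₀, 2R₁}: four distinct values, and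
-- adjacent vertices get different ones because their neighbours have different parities. For odd
-- m both endpoints are even, so R₀ never occurs.

module Submission where

open import Defs
open import Data.Nat using (ℕ; zero; suc; _+_; _*_; _≤_; _<_; _%_; _≟_; pred; z≤n; z<s; s≤s; s≤s⁻¹; NonZero; ⌊_/2⌋; ⌈_/2⌉)
open import Data.Nat.Properties
open import Data.Nat.DivMod using (m%n<n; m*n%n≡0; [m+kn]%n≡m%n)
open import Data.Nat.Tactic.RingSolver using (solve-∀)
open import Data.Fin as Fin using (Fin; zero; suc; toℕ; fromℕ<; inject₁)
open import Data.Fin.Properties using (opposite-prop; *↔×; +↔⊎; toℕ-↑ˡ; toℕ-↑ʳ; toℕ-cast; toℕ-combine; toℕ-injective; toℕ-fromℕ<; toℕ-inject₁; toℕ<n; injective⇒≤)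
open import Data.List using (List; []; _∷_; _++_; map; tabulate; filter; allFin; length; lookup; cartesianProduct)
open import Data.List.Properties using (map-tabulate; tabulate-cong; length-map; map-++; map-∘; filter-++; filter-all; filter-none; filter-≐)
open import Data.Nat.ListAction using (sum)
open import Data.Nat.ListAction.Properties using (sum-++)
open import Data.List.Membership.Propositional using (_∈_)
open import Data.List.Membership.Propositional.Properties using (∈-lookup; ∈-map⁻; ∈-filter⁺; ∈-filter⁻; ∈-allFin)
open import Data.List.Relation.Unary.All as All using (All; []; _∷_)
open import Data.List.Relation.Unary.Any using (here; there; index)
open import Data.List.Relation.Unary.Any.Properties using (lookup-index)
open import Data.List.Relation.Unary.AllPairs using ([]; _∷_)
open import Data.List.Relation.Unary.Unique.Propositional using (Unique)
import Data.List.Relation.Unary.Unique.Propositional.Properties as Unique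
open import Data.List.Relation.Unary.Unique.DecPropositional.Properties _≟_ using (deduplicate-!)
open import Data.List.Relation.Unary.All.Properties using (all-filter; deduplicate⁺) renaming (map⁺ to All-map⁺)
open import Data.Product using (Σ; _×_; _,_; proj₁; proj₂)
open import Data.Sum as Sum using (_⊎_; inj₁; inj₂; [_,_]′)
open import Relation.Binary.PropositionalEquality
open import Relation.Nullary using (yes; no; contradiction)
open import Relation.Unary using (Pred; Decidable; _≐_)
open import Algebra.Properties.CommutativeSemigroup +-commutativeSemigroup using (interchange)
open import Function using (id; _∘_; _$_; _↔_; mk↔ₛ′)
open import Function.Construct.Composition using (_↔-∘_)
open import Function.Construct.Symmetry using (↔-sym)
open import Function.Properties.Inverse using (↔⇒⤖)
open import Data.Fin.Permutation as Perm using (Permutation′; _⟨$⟩ʳ_; _⟨$⟩ˡ_; inverseˡ; inverseʳ; cast-id; reverse)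
open import Level using (0ℓ)

private
  variable
    A B : Set
    m n : ℕ

%2-suc-≢ : ∀ x → x % 2 ≢ suc x % 2
%2-suc-≢ 0 ()
%2-suc-≢ 1 ()
%2-suc-≢ (suc (suc x)) = %2-suc-≢ x

%2≡0⊎1 : ∀ x → x % 2 ≡ 0 ⊎ x % 2 ≡ 1
%2≡0⊎1 0 = inj₁ refl
%2≡0⊎1 1 = inj₂ refl
%2≡0⊎1 (suc (suc x)) = %2≡0⊎1 x

%4≡3⇒%2≡1 : ∀ m → m % 4 ≡ 3 → m % 2 ≡ 1
%4≡3⇒%2≡1 0 ()
%4≡3⇒%2≡1 1 ()
%4≡3⇒%2≡1 2 ()
%4≡3⇒%2≡1 3 _ = refl
%4≡3⇒%2≡1 (suc (suc (suc (suc m)))) = %4≡3⇒%2≡1 m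

odd-decomposition : ∀ n → 1 < n → n % 2 ≡ 1 → Σ ℕ (λ k → n ≡ 3 + k * 2)
odd-decomposition 0 () _
odd-decomposition 1 (s≤s ()) _
odd-decomposition 2 _ ()
odd-decomposition 3 _ _ = 0 , refl
odd-decomposition (suc (suc (suc (suc n)))) _ n-odd with odd-decomposition (suc (suc n)) (s≤s (s≤s z≤n)) n-odd
... | k , eq = suc k , cong (2 +_) eq

lookup-injective : {xs : List A} → Unique xs → ∀ {i j} → lookup xs i ≡ lookup xs j → i ≡ j
lookup-injective (_ ∷ _) {zero} {zero} _ = refl
lookup-injective (x∉xs ∷ _) {zero} {suc j} eq = contradiction eq (All.lookup x∉xs (∈-lookup j))
lookup-injective (x∉xs ∷ _) {suc i} {zero} eq = contradiction (sym eq) (All.lookup x∉xs (∈-lookup i))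
lookup-injective (_ ∷ u) {suc i} {suc j} eq = cong suc (lookup-injective u eq)

Unique⇒length≤ : {xs ys : List A} → Unique xs → All (_∈ ys) xs → length xs ≤ length ys
Unique⇒length≤ {xs = xs} {ys} u xs⊆ys = injective⇒≤ position-injective
  where
  position : Fin (length xs) → Fin (length ys)
  position i = index (All.lookup xs⊆ys (∈-lookup i))

  position-injective : ∀ {i j} → position i ≡ position j → i ≡ j
  position-injective {i} {j} eq = lookup-injective u (begin
    lookup xs i              ≡⟨ lookup-index (All.lookup xs⊆ys (∈-lookup i)) ⟩
    lookup ys (position i)   ≡⟨ cong (lookup ys) eq ⟩
    lookup ys (position j)   ≡⟨ sym (lookup-index (All.lookup xs⊆ys (∈-lookup j))) ⟩
    lookup xs j              ∎)
    where open ≡-Reasoning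

sum-map-filter-++ : {P : Pred A 0ℓ} (P? : Decidable P) (F : A → ℕ) (xs ys : List A) →
  sum (map F (filter P? (xs ++ ys))) ≡ sum (map F (filter P? xs)) + sum (map F (filter P? ys))
sum-map-filter-++ P? F xs ys = begin
  sum (map F (filter P? (xs ++ ys)))                  ≡⟨ cong (sum ∘ map F) (filter-++ P? xs ys) ⟩
  sum (map F (filter P? xs ++ filter P? ys))          ≡⟨ cong sum (map-++ F (filter P? xs) (filter P? ys)) ⟩
  sum (map F (filter P? xs) ++ map F (filter P? ys))  ≡⟨ sum-++ (map F (filter P? xs)) (map F (filter P? ys)) ⟩
  sum (map F (filter P? xs)) + sum (map F (filter P? ys)) ∎
  where open ≡-Reasoning

sum-filter-cartesianProduct : {P : Pred A 0ℓ} (P? : Decidable P) (F : A × B → ℕ) (xs : List A) (ys : List B) →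
  sum (map F (filter (P? ∘ proj₁) (cartesianProduct xs ys)))
    ≡ sum (map (λ x → sum (map (λ y → F (x , y)) ys)) (filter P? xs))
sum-filter-cartesianProduct P? F [] ys = refl
sum-filter-cartesianProduct {A = A} P? F (x ∷ xs) ys =
  trans (sum-map-filter-++ (P? ∘ proj₁) F (map (x ,_) ys) (cartesianProduct xs ys))
        (trans (cong₂ _+_ first-row (sum-filter-cartesianProduct P? F xs ys))
               (sym (sum-map-filter-++ P? rowTotal (x ∷ []) xs)))
  where
  open ≡-Reasoning
  rowTotal : A → ℕ
  rowTotal x′ = sum (map (λ y → F (x′ , y)) ys)

  first-row : sum (map F (filter (P? ∘ proj₁) (map (x ,_) ys))) ≡ sum (map rowTotal (filter P? (x ∷ [])))
  first-row with P? x
  ... | yes px = begin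
    sum (map F (filter (P? ∘ proj₁) (map (x ,_) ys)))
      ≡⟨ cong (sum ∘ map F) (filter-all (P? ∘ proj₁) (All-map⁺ (All.universal (λ _ → px) ys))) ⟩
    sum (map F (map (x ,_) ys))  ≡⟨ cong sum (map-∘ ys) ⟨
    rowTotal x                     ≡⟨ +-identityʳ (rowTotal x) ⟨
    rowTotal x + 0                 ∎
  ... | no ¬px = cong (sum ∘ map F) (filter-none (P? ∘ proj₁) (All-map⁺ (All.universal (λ _ → ¬px) ys)))

sum-map-const : {F : A → ℕ} {c : ℕ} (xs : List A) → All (λ x → F x ≡ c) xs → sum (map F xs) ≡ length xs * c
sum-map-const [] [] = refl
sum-map-const (x ∷ xs) (Fx≡c ∷ Fxs≡c) = cong₂ _+_ Fx≡c (sum-map-const xs Fxs≡c)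

sum-tabulate-+ : (f g : Fin n → ℕ) → sum (tabulate (λ i → f i + g i)) ≡ sum (tabulate f) + sum (tabulate g)
sum-tabulate-+ {zero} f g = refl
sum-tabulate-+ {suc n} f g = trans (cong (f zero + g zero +_) (sum-tabulate-+ (f ∘ suc) (g ∘ suc)))
                                   (interchange (f zero) (g zero) _ _)

neighbours : Fin m → List (Fin m)
neighbours {m} g = filter (pathAdj? m g) (allFin m)

degree : Fin m → ℕ
degree g = length (neighbours g)

neighbour-parity : {g g' : Fin m} → PathAdj m g g' → toℕ g' % 2 ≡ suc (toℕ g) % 2
neighbour-parity (inj₁ eq) = cong (_% 2) (sym eq)
neighbour-parity (inj₂ eq) = cong (λ x → suc x % 2) eq

length≤degree : (g : Fin m) {gs : List (Fin m)} → Unique gs → All (PathAdj m g) gs → length gs ≤ degree g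
length≤degree {m} g u adjacent =
  Unique⇒length≤ u (All.map (λ {g'} → ∈-filter⁺ (pathAdj? m g) (∈-allFin g')) adjacent)

degree≤2 : (g : Fin m) → degree g ≤ 2
degree≤2 {m} g = begin
  degree g                         ≡⟨ length-map toℕ (neighbours g) ⟨
  length (map toℕ (neighbours g))  ≤⟨ Unique⇒length≤ unique (All.tabulate next-or-previous) ⟩
  2                                ∎
  where
  open ≤-Reasoning
  unique : Unique (map toℕ (neighbours g))
  unique = Unique.map⁺ toℕ-injective (Unique.filter⁺ (pathAdj? m g) (Unique.allFin⁺ m))

  next-or-previous : ∀ {y} → y ∈ map toℕ (neighbours g) → y ∈ suc (toℕ g) ∷ pred (toℕ g) ∷ []
  next-or-previous y∈ with ∈-map⁻ toℕ y∈
  ... | g' , g'∈ , refl with proj₂ (∈-filter⁻ (pathAdj? m g) {xs = allFin m} g'∈)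
  ...   | inj₁ eq = here (sym eq)
  ...   | inj₂ eq = there (here (cong pred eq))

1≤degree : 2 ≤ m → (g : Fin m) → 1 ≤ degree g
1≤degree {suc zero} (s≤s ()) zero
1≤degree {suc (suc m)} _ zero = length≤degree {suc (suc m)} zero ([] ∷ []) (inj₁ refl ∷ [])
1≤degree _ (suc g) = length≤degree (suc g) ([] ∷ []) (inj₂ (cong suc (toℕ-inject₁ g)) ∷ [])

2≤degree : (g : Fin m) → suc (toℕ (suc g)) < suc m → 2 ≤ degree (suc g)
2≤degree {m} g interior = length≤degree (suc g) unique adjacent
  where
  previous next : Fin (suc m)
  previous = inject₁ g
  next = fromℕ< interior
  adjacent : All (PathAdj (suc m) (suc g)) (previous ∷ next ∷ [])
  adjacent = inj₂ (cong suc (toℕ-inject₁ g)) ∷ inj₁ (sym (toℕ-fromℕ< interior)) ∷ []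
  previous<next : toℕ previous < toℕ next
  previous<next = subst₂ _<_ (sym (toℕ-inject₁ g)) (sym (toℕ-fromℕ< interior)) (m≤n⇒m≤1+n (n<1+n (toℕ g)))
  unique : Unique (previous ∷ next ∷ [])
  unique = ((λ eq → <⇒≢ previous<next (cong toℕ eq)) ∷ []) ∷ ([] ∷ [])

degree≡1⊎2 : 2 ≤ m → (g : Fin m) → degree g ≡ 1 ⊎ degree g ≡ 2
degree≡1⊎2 m≥2 g with degree g | 1≤degree m≥2 g | degree≤2 g
... | 1 | _ | _ = inj₁ refl
... | 2 | _ | _ = inj₂ refl
... | suc (suc (suc _)) | _ | s≤s (s≤s ())

degree≡1⇒endpoint : (g : Fin m) → degree g ≡ 1 → toℕ g ≡ 0 ⊎ suc (toℕ g) ≡ m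
degree≡1⇒endpoint zero _ = inj₁ refl
degree≡1⇒endpoint (suc g) d≡1 with m≤n⇒m<n∨m≡n (toℕ<n (suc g))
... | inj₁ interior = contradiction (subst (2 ≤_) d≡1 (2≤degree g interior)) λ { (s≤s ()) }
... | inj₂ last = inj₂ last

rowSum : Labeling m n → Fin m → ℕ
rowSum {n = n} f g = sum (map (λ h → label f (g , h)) (allFin n))

weight≡sum-rowSum : (f : Labeling m n) (g : Fin m) (h : Fin n) →
  weight f (g , h) ≡ sum (map (rowSum f) (neighbours g))
weight≡sum-rowSum {m} {n} f g h = begin
  weight f (g , h)
    ≡⟨ cong (sum ∘ map (label f)) (filter-≐ (lexAdj? m n (g , h)) (pathAdj? m g ∘ proj₁) lex⇔path (vertices m n)) ⟩
  sum (map (label f) (filter (pathAdj? m g ∘ proj₁) (vertices m n)))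
    ≡⟨ sum-filter-cartesianProduct (pathAdj? m g) (label f) (allFin m) (allFin n) ⟩
  sum (map (rowSum f) (neighbours g))
    ∎
  where
  open ≡-Reasoning
  lex⇔path : LexAdj m n (g , h) ≐ (PathAdj m g ∘ proj₁)
  lex⇔path = (λ { (inj₁ adj) → adj ; (inj₂ (_ , ())) }) , inj₁

weight-of-parity-rowSums : (f : Labeling m n) (ρ : ℕ → ℕ) → (∀ g → rowSum f g ≡ ρ (toℕ g % 2)) →
  ∀ g h → weight f (g , h) ≡ degree g * ρ (suc (toℕ g) % 2)
weight-of-parity-rowSums {m} f ρ rowSum≡ρ g h = trans (weight≡sum-rowSum f g h)
  (sum-map-const (neighbours g) (All.map (λ {g'} adj → trans (rowSum≡ρ g') (cong ρ (neighbour-parity adj)))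
                                         (all-filter (pathAdj? m g) (allFin m))))

numWeights≤ : (f : Labeling m n) (ws : List ℕ) → (∀ v → weight f v ∈ ws) → numWeights f ≤ length ws
numWeights≤ {m} {n} f ws weight∈ws = Unique⇒length≤ (deduplicate-! (map (weight f) (vertices m n)))
  (deduplicate⁺ _≟_ (All-map⁺ (All.universal weight∈ws (vertices m n))))

labelling : (Fin n → Permutation′ m) → Labeling m n
labelling {n} {m} π = ↔⇒⤖ (cast-id (*-comm n m) ↔-∘ (↔-sym *↔× ↔-∘ twist))
  where
  twist : (Fin m × Fin n) ↔ (Fin n × Fin m)
  twist = mk↔ₛ′ (λ (g , h) → h , π h ⟨$⟩ʳ g) (λ (h , j) → π h ⟨$⟩ˡ j , h)
                (λ (h , j) → cong (h ,_) (inverseʳ (π h))) (λ (g , h) → cong (_, h) (inverseˡ (π h)))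

label-labelling : (π : Fin n → Permutation′ m) (g : Fin m) (h : Fin n) →
  label (labelling π) (g , h) ≡ suc (m * toℕ h + toℕ (π h ⟨$⟩ʳ g))
label-labelling {n} {m} π g h = cong suc (trans (toℕ-cast (*-comm n m) _) (toℕ-combine h (π h ⟨$⟩ʳ g)))

rowSum-labelling : (π : Fin n → Permutation′ m) (g : Fin m) →
  rowSum (labelling π) g
    ≡ sum (tabulate {n = n} (λ h → suc (m * toℕ h))) + sum (tabulate (λ h → toℕ (π h ⟨$⟩ʳ g)))
rowSum-labelling {n} {m} π g = begin
  rowSum (labelling π) g
    ≡⟨ cong sum (map-tabulate {n = n} id (λ h → label (labelling π) (g , h))) ⟩
  sum (tabulate (λ h → label (labelling π) (g , h)))
    ≡⟨ cong sum (tabulate-cong (label-labelling π g)) ⟩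
  sum (tabulate (λ h → suc (m * toℕ h) + toℕ (π h ⟨$⟩ʳ g)))
    ≡⟨ sum-tabulate-+ (λ h → suc (m * toℕ h)) (λ h → toℕ (π h ⟨$⟩ʳ g)) ⟩
  sum (tabulate {n = n} (λ h → suc (m * toℕ h))) + sum (tabulate (λ h → toℕ (π h ⟨$⟩ʳ g)))
    ∎
  where open ≡-Reasoning

splitParity : Fin m → Fin ⌈ m /2⌉ ⊎ Fin ⌊ m /2⌋
splitParity {suc _} zero = inj₁ zero
splitParity {suc zero} (suc ())
splitParity {suc (suc _)} (suc zero) = inj₂ zero
splitParity {suc (suc _)} (suc (suc i)) = Sum.map suc suc (splitParity i)

joinParity : Fin ⌈ m /2⌉ ⊎ Fin ⌊ m /2⌋ → Fin m
joinParity {suc _} (inj₁ zero) = zero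
joinParity {suc (suc _)} (inj₁ (suc j)) = suc (suc (joinParity (inj₁ j)))
joinParity {suc (suc _)} (inj₂ zero) = suc zero
joinParity {suc (suc _)} (inj₂ (suc j)) = suc (suc (joinParity (inj₂ j)))

joinParity-splitParity : (i : Fin m) → joinParity (splitParity i) ≡ i
joinParity-splitParity {suc _} zero = refl
joinParity-splitParity {suc (suc _)} (suc zero) = refl
joinParity-splitParity {suc (suc _)} (suc (suc i)) with splitParity i | joinParity-splitParity i
... | inj₁ j | eq = cong (Fin.suc ∘ Fin.suc) eq
... | inj₂ j | eq = cong (Fin.suc ∘ Fin.suc) eq

splitParity-joinParity : (j : Fin ⌈ m /2⌉ ⊎ Fin ⌊ m /2⌋) → splitParity {m} (joinParity j) ≡ j
splitParity-joinParity {suc _} (inj₁ zero) = refl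
splitParity-joinParity {suc (suc _)} (inj₁ (suc j)) = cong (Sum.map suc suc) (splitParity-joinParity (inj₁ j))
splitParity-joinParity {suc (suc _)} (inj₂ zero) = refl
splitParity-joinParity {suc (suc _)} (inj₂ (suc j)) = cong (Sum.map suc suc) (splitParity-joinParity (inj₂ j))

toℕ-splitParity : (i : Fin m) → toℕ i ≡ [ (λ j → toℕ j * 2) , (λ j → suc (toℕ j * 2)) ]′ (splitParity i)
toℕ-splitParity {suc _} zero = refl
toℕ-splitParity {suc (suc _)} (suc zero) = refl
toℕ-splitParity {suc (suc _)} (suc (suc i)) with splitParity i | toℕ-splitParity i
... | inj₁ j | eq = cong (2 +_) eq
... | inj₂ j | eq = cong (2 +_) eq

unshuffle : Permutation′ m
unshuffle {m} = cast-id ⌈m/2⌉+⌊m/2⌋≡m ↔-∘ (↔-sym +↔⊎ ↔-∘ parity↔)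
  where
  ⌈m/2⌉+⌊m/2⌋≡m : ⌈ m /2⌉ + ⌊ m /2⌋ ≡ m
  ⌈m/2⌉+⌊m/2⌋≡m = trans (+-comm ⌈ m /2⌉ ⌊ m /2⌋) (⌊n/2⌋+⌈n/2⌉≡n m)
  parity↔ : Fin m ↔ (Fin ⌈ m /2⌉ ⊎ Fin ⌊ m /2⌋)
  parity↔ = mk↔ₛ′ splitParity joinParity splitParity-joinParity joinParity-splitParity

toℕ-unshuffle : (i : Fin m) → toℕ (unshuffle ⟨$⟩ʳ i) ≡ [ toℕ , (λ j → ⌈ m /2⌉ + toℕ j) ]′ (splitParity i)
toℕ-unshuffle {m} i = trans (toℕ-cast _ _) (toℕ-join (splitParity i))
  where
  toℕ-join : (j : Fin ⌈ m /2⌉ ⊎ Fin ⌊ m /2⌋) →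
    toℕ (Fin.join ⌈ m /2⌉ ⌊ m /2⌋ j) ≡ [ toℕ , (λ j → ⌈ m /2⌉ + toℕ j) ]′ j
  toℕ-join (inj₁ j) = toℕ-↑ˡ j ⌊ m /2⌋
  toℕ-join (inj₂ j) = toℕ-↑ʳ ⌈ m /2⌉ j

oddShift : ℕ → ℕ
oddShift m = suc (⌊ m /2⌋ * 2)

unshuffle-double : (i : Fin (suc m)) →
  toℕ (unshuffle ⟨$⟩ʳ i) + toℕ (unshuffle ⟨$⟩ʳ i) ≡ toℕ i + toℕ i % 2 * oddShift m
unshuffle-double {m} i with splitParity i | toℕ-unshuffle i | toℕ-splitParity i
... | inj₁ j | e≡ | i≡ = trans (cong₂ _+_ e≡ e≡) $ begin
  toℕ j + toℕ j
    ≡⟨ even (toℕ j) (oddShift m) ⟩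
  toℕ j * 2 + 0 * oddShift m
    ≡⟨ cong (λ r → toℕ j * 2 + r * oddShift m) (m*n%n≡0 (toℕ j) 2) ⟨
  toℕ j * 2 + toℕ j * 2 % 2 * oddShift m
    ≡⟨ cong (λ x → x + x % 2 * oddShift m) i≡ ⟨
  toℕ i + toℕ i % 2 * oddShift m
    ∎
  where
  open ≡-Reasoning
  even : ∀ t δ → t + t ≡ t * 2 + 0 * δ
  even = solve-∀
... | inj₂ j | e≡ | i≡ = trans (cong₂ _+_ e≡ e≡) $ begin
  (suc ⌊ m /2⌋ + toℕ j) + (suc ⌊ m /2⌋ + toℕ j)
    ≡⟨ odd ⌊ m /2⌋ (toℕ j) ⟩
  suc (toℕ j * 2) + 1 * oddShift m
    ≡⟨ cong (λ r → suc (toℕ j * 2) + r * oddShift m) ([m+kn]%n≡m%n 1 (toℕ j) 2) ⟨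
  suc (toℕ j * 2) + suc (toℕ j * 2) % 2 * oddShift m
    ≡⟨ cong (λ x → x + x % 2 * oddShift m) i≡ ⟨
  toℕ i + toℕ i % 2 * oddShift m
    ∎
  where
  open ≡-Reasoning
  odd : ∀ h t → (suc h + t) + (suc h + t) ≡ suc (t * 2) + 1 * suc (h * 2)
  odd = solve-∀

toℕ+toℕ-opposite : (g : Fin (suc m)) → toℕ g + toℕ (Fin.opposite g) ≡ m
toℕ+toℕ-opposite {m} g = trans (cong (toℕ g +_) (opposite-prop g)) (m+[n∸m]≡n (s≤s⁻¹ (toℕ<n g)))

alternating : {j : ℕ} → Fin j → Permutation′ m
alternating zero = Perm.id
alternating (suc zero) = reverse
alternating (suc (suc h)) = alternating h

alternating-sum : (k : ℕ) (g : Fin (suc m)) →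
  sum (tabulate {n = k * 2} (λ h → toℕ (alternating h ⟨$⟩ʳ g))) ≡ k * m
alternating-sum zero g = refl
alternating-sum (suc k) g =
  trans (sym (+-assoc (toℕ g) _ _)) (cong₂ _+_ (toℕ+toℕ-opposite g) (alternating-sum k g))

columnPermutations : (k : ℕ) → Fin (3 + k * 2) → Permutation′ m
columnPermutations k zero = reverse
columnPermutations k (suc zero) = unshuffle
columnPermutations k (suc (suc zero)) = unshuffle
columnPermutations k (suc (suc (suc h))) = alternating h

column-sum : (k : ℕ) (g : Fin (suc m)) →
  sum (tabulate (λ h → toℕ (columnPermutations k h ⟨$⟩ʳ g))) ≡ suc k * m + toℕ g % 2 * oddShift m
column-sum {m} k g = begin
  o + (e + (e + sum (tabulate {n = k * 2} (λ h → toℕ (alternating h ⟨$⟩ʳ g)))))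
                               ≡⟨ cong (λ s → o + (e + (e + s))) (alternating-sum k g) ⟩
  o + (e + (e + k * m))        ≡⟨ regroup₁ o e (k * m) ⟩
  (o + (e + e)) + k * m        ≡⟨ cong (λ s → (o + s) + k * m) (unshuffle-double g) ⟩
  (o + (x + p * δ)) + k * m    ≡⟨ regroup₂ o x (p * δ) (k * m) ⟩
  ((x + o) + k * m) + p * δ    ≡⟨ cong (λ s → (s + k * m) + p * δ) (toℕ+toℕ-opposite g) ⟩
  suc k * m + p * δ            ∎
  where
  open ≡-Reasoning
  x = toℕ g
  o = toℕ (Fin.opposite g)
  e = toℕ (unshuffle ⟨$⟩ʳ g)
  p = toℕ g % 2
  δ = oddShift m
  regroup₁ : ∀ a b c → a + (b + (b + c)) ≡ (a + (b + b)) + c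
  regroup₁ = solve-∀
  regroup₂ : ∀ a b c d → (a + (b + c)) + d ≡ ((b + a) + d) + c
  regroup₂ = solve-∀

offset-injective : ∀ {A δ p p'} .{{_ : NonZero δ}} → A + p * δ ≡ A + p' * δ → p ≡ p'
offset-injective {A} {δ} {p} {p'} = *-cancelʳ-≡ p p' δ ∘ +-cancelˡ-≡ A (p * δ) (p' * δ)

offset<double : ∀ {A δ p p'} → δ < A → p < 2 → A + p * δ < 2 * (A + p' * δ)
offset<double {A} {δ} {p} {p'} δ<A p<2 = begin-strict
  A + p * δ                    ≤⟨ +-monoʳ-≤ A (≤-trans (*-monoˡ-≤ δ (s≤s⁻¹ p<2)) (≤-reflexive (*-identityˡ δ))) ⟩
  A + δ                        <⟨ +-monoʳ-< A δ<A ⟩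
  A + A                        ≤⟨ +-mono-≤ (m≤m+n A (p' * δ)) (m≤m+n A (p' * δ)) ⟩
  (A + p' * δ) + (A + p' * δ)  ≡⟨ cong ((A + p' * δ) +_) (+-identityʳ (A + p' * δ)) ⟨
  2 * (A + p' * δ)             ∎
  where open ≤-Reasoning

scaled-offsets-separated : ∀ {A δ d d' p p'} .{{_ : NonZero δ}} → δ < A →
  d ≡ 1 ⊎ d ≡ 2 → d' ≡ 1 ⊎ d' ≡ 2 → p < 2 → p' < 2 → d * (A + p * δ) ≡ d' * (A + p' * δ) → p ≡ p'
scaled-offsets-separated {A} _ (inj₁ refl) (inj₁ refl) _ _ eq =
  offset-injective {A} (trans (sym (*-identityˡ _)) (trans eq (*-identityˡ _)))
scaled-offsets-separated {A} {δ} {p = p} {p'} _ (inj₂ refl) (inj₂ refl) _ _ eq =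
  offset-injective {A} (*-cancelˡ-≡ (A + p * δ) (A + p' * δ) 2 eq)
scaled-offsets-separated {p' = p'} δ<A (inj₁ refl) (inj₂ refl) p<2 _ eq =
  contradiction (trans (sym (*-identityˡ _)) eq) (<⇒≢ (offset<double {p' = p'} δ<A p<2))
scaled-offsets-separated {p = p} δ<A (inj₂ refl) (inj₁ refl) _ p'<2 eq =
  contradiction (trans (sym (*-identityˡ _)) (sym eq)) (<⇒≢ (offset<double {p' = p} δ<A p'<2))

module ParityLabelling (m k : ℕ) (1≤m : 1 ≤ m) where

  L : Labeling (suc m) (3 + k * 2)
  L = labelling (columnPermutations k)

  columnOffsets : ℕ
  columnOffsets = sum (tabulate {n = 3 + k * 2} (λ h → suc (suc m * toℕ h)))

  base δ : ℕ
  base = columnOffsets + suc k * m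
  δ = oddShift m

  ρ : ℕ → ℕ
  ρ p = base + p * δ

  rowSum-L : ∀ g → rowSum L g ≡ ρ (toℕ g % 2)
  rowSum-L g = begin
    rowSum L g
      ≡⟨ rowSum-labelling (columnPermutations k) g ⟩
    columnOffsets + sum (tabulate (λ h → toℕ (columnPermutations k h ⟨$⟩ʳ g)))
      ≡⟨ cong (columnOffsets +_) (column-sum k g) ⟩
    columnOffsets + (suc k * m + toℕ g % 2 * δ)
      ≡⟨ +-assoc columnOffsets _ _ ⟨
    ρ (toℕ g % 2)
      ∎
    where open ≡-Reasoning

  weight-L : ∀ g h → weight L (g , h) ≡ degree g * ρ (suc (toℕ g) % 2)
  weight-L = weight-of-parity-rowSums L ρ rowSum-L

  δ<base : δ < base
  δ<base = begin-strict
    suc (⌊ m /2⌋ * 2)    ≤⟨ s≤s (*-monoˡ-≤ 2 (⌊n/2⌋≤n m)) ⟩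
    suc (m * 2)          <⟨ m<n+m (suc (m * 2)) {2} z<s ⟩
    suc (suc m * 2)      ≤⟨ m≤n⇒m≤o+n (suc (suc m * 0)) $ m≤n⇒m≤o+n (suc (suc m * 1)) $ m≤m+n (suc (suc m * 2)) _ ⟩
    columnOffsets        ≤⟨ m≤m+n columnOffsets (suc k * m) ⟩
    base                 ∎
    where open ≤-Reasoning

  2≤1+m : 2 ≤ suc m
  2≤1+m = s≤s 1≤m

  isLDA : IsLDA L
  isLDA (g , h) (g' , h') (inj₂ (_ , ()))
  isLDA (g , h) (g' , h') (inj₁ g~g') w≡w' =
    %2-suc-≢ (toℕ g') (trans (neighbour-parity g~g') same-parity)
    where
    same-parity : suc (toℕ g) % 2 ≡ suc (toℕ g') % 2
    same-parity = scaled-offsets-separated δ<base (degree≡1⊎2 2≤1+m g) (degree≡1⊎2 2≤1+m g')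
      (m%n<n (suc (toℕ g)) 2) (m%n<n (suc (toℕ g')) 2)
      (trans (sym (weight-L g h)) (trans w≡w' (weight-L g' h')))

  weight-L≡ : ∀ g h {d p} → degree g ≡ d → suc (toℕ g) % 2 ≡ p → weight L (g , h) ≡ d * ρ p
  weight-L≡ g h refl refl = weight-L g h

  weight∈four : ∀ v → weight L v ∈ 1 * ρ 0 ∷ 1 * ρ 1 ∷ 2 * ρ 0 ∷ 2 * ρ 1 ∷ []
  weight∈four (g , h) with degree≡1⊎2 2≤1+m g | %2≡0⊎1 (suc (toℕ g))
  ... | inj₁ d≡1 | inj₁ p≡0 = here (weight-L≡ g h d≡1 p≡0)
  ... | inj₁ d≡1 | inj₂ p≡1 = there (here (weight-L≡ g h d≡1 p≡1))
  ... | inj₂ d≡2 | inj₁ p≡0 = there (there (here (weight-L≡ g h d≡2 p≡0)))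
  ... | inj₂ d≡2 | inj₂ p≡1 = there (there (there (here (weight-L≡ g h d≡2 p≡1))))

  module _ (m-odd : suc m % 2 ≡ 1) where

    endpoint-parity : {g : Fin (suc m)} → toℕ g ≡ 0 ⊎ suc (toℕ g) ≡ suc m → suc (toℕ g) % 2 ≡ 1
    endpoint-parity (inj₁ first) = cong (λ x → suc x % 2) first
    endpoint-parity (inj₂ last) = trans (cong (_% 2) last) m-odd

    weight∈three : ∀ v → weight L v ∈ 1 * ρ 1 ∷ 2 * ρ 0 ∷ 2 * ρ 1 ∷ []
    weight∈three (g , h) with degree≡1⊎2 2≤1+m g
    ... | inj₁ d≡1 = here (weight-L≡ g h d≡1 (endpoint-parity (degree≡1⇒endpoint g d≡1)))
    ... | inj₂ d≡2 with %2≡0⊎1 (suc (toℕ g))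
    ...   | inj₁ p≡0 = there (here (weight-L≡ g h d≡2 p≡0))
    ...   | inj₂ p≡1 = there (there (here (weight-L≡ g h d≡2 p≡1)))

χld≤4 : ∀ m k → 1 ≤ m → χld≤ (suc m) (3 + k * 2) 4
χld≤4 m k 1≤m = L , isLDA , numWeights≤ L _ weight∈four
  where open ParityLabelling m k 1≤m

χld≤3 : ∀ m k → 1 ≤ m → suc m % 2 ≡ 1 → χld≤ (suc m) (3 + k * 2) 3
χld≤3 m k 1≤m m-odd = L , isLDA , numWeights≤ L _ (weight∈three m-odd)
  where open ParityLabelling m k 1≤m

mainTheorem13 : (m n : ℕ) → 1 < n → n % 2 ≡ 1 → 3 ≤ m →
    ((m % 4 ≡ 1 → χld≤ m n 4) × (m % 4 ≡ 3 → χld≤ m n 3) × (m % 2 ≡ 0 → χld≤ m n 4))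
mainTheorem13 (suc m) n 1<n n-odd (s≤s 2≤m) with odd-decomposition n 1<n n-odd
... | k , refl =
  (λ _ → χld≤4 m k 1≤m) , (λ m%4≡3 → χld≤3 m k 1≤m (%4≡3⇒%2≡1 (suc m) m%4≡3)) , (λ _ → χld≤4 m k 1≤m)
  where
  1≤m : 1 ≤ m
  1≤m = ≤-trans (s≤s z≤n) 2≤m
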